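{- Let $p$ be a prime, $\mathbf{a}_1,\mathbf{a}_2\in\mathbb{F}_p^n$, $\mathbf{b}_1,\mathbf{b}_2\in\mathbb{F}_p$, and $\theta:=\mathrm{lv}(\mathbf{a}_1,\mathbf{a}_2)$. Then for every clause $c\in F(\mathbf{a}_1+\mathbf{a}_2,\mathbf{b}_1+\mathbf{b}_2)$ we have $F(\mathbf{a}_1,\mathbf{b}_1)\cup F(\mathbf{a}_2,\mathbf{b}_2)\cup V\vdash^w_{2(p^{|\theta|}-1)} c$, i.e. there is a resolution derivation of length at most $2(p^{|\theta|}-1)$ from $F(\mathbf{a}_1,\mathbf{b}_1)\cup F(\mathbf{a}_2,\mathbf{b}_2)\cup V$ that contains (among original and derived clauses) a clause $c'$ with $c'\subseteq c$.
   Context: Variables $\xi_{i,k}$ for $i\in[1,n]$, $k\in\mathbb{F}_p$; clauses are sets of literals. $\mathrm{supp}(\mathbf{r})=\{i: r_i\neq0\}$. $\mathrm{lv}(\mathbf{x},\mathbf{y})=(\mathrm{supp}(\mathbf{x})\cup\mathrm{supp}(\mathbf{y}))\setminus\mathrm{supp}(\mathbf{x}+\mathbf{y})$. For $\mathbf{a}\in\mathbb{F}_p^n$, $b\in\mathbb{F}_p$: $P(\mathbf{a},b)=\{\mathbf{x}\in\mathbb{F}_p^n:\mathbf{a}\cdot\mathbf{x}\neq b,\ \mathrm{supp}(\mathbf{x})\subseteq\mathrm{supp}(\mathbf{a})\}$, $C_{\mathbf{a}}(\mathbf{x})=\bigvee_{i\in\mathrm{supp}(\mathbf{a})}\overline{\xi_{i,\mathbf{x}_i}}$,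 $F(\mathbf{a},b)=\bigwedge_{\mathbf{x}\in P(\mathbf{a},b)}C_{\mathbf{a}}(\mathbf{x})$. $V=\bigwedge_{i=1}^n\bigvee_{k\in\mathbb{F}_p}\xi_{i,k}$. Resolution: from $x\vee A$, $\overline{x}\vee B$ derive $A\vee B$; length = number of derived clauses. -}

module Defs where

open import Data.Nat using (ℕ; zero; suc; _+_; _*_; NonZero)
open import Data.Nat.DivMod using (_mod_)
open import Data.Fin using (Fin; toℕ)
open import Data.Fin.Properties using () renaming (_≟_ to _≟F_)
open import Data.Bool using (Bool; true; false; _∧_; _∨_; not; T)
open import Data.Product using (Σ; ∃; _×_; _,_)
open import Data.Sum using (_⊎_)
open import Data.List using (List; []; _∷_)
open import Data.List.Membership.Propositional using (_∈_)
open import Relation.Nullary using (¬_; Dec; yes; no)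
open import Relation.Nullary.Decidable using (⌊_⌋)
open import Relation.Binary.PropositionalEquality using (_≡_; refl; cong)

Fp : ℕ → Set
Fp p = Fin p

module _ {p : ℕ} .{{_ : NonZero p}} where
  zeroₚ : Fp p
  zeroₚ = 0 mod p

  _+ₚ_ : Fp p → Fp p → Fp p
  x +ₚ y = (toℕ x + toℕ y) mod p

Vecₚ : ℕ → ℕ → Set
Vecₚ p n = Fin n → Fp p

sumFin : {n : ℕ} → (Fin n → ℕ) → ℕ
sumFin {zero} f = 0
sumFin {suc n} f = f Fin.zero + sumFin (λ i → f (Fin.suc i))

count : {n : ℕ} → (Fin n → Bool) → ℕ
count f = sumFin (λ i → if-b (f i))
  where
  if-b : Bool → ℕ
  if-b true = 1
  if-b false = 0

module _ {p : ℕ} .{{_ : NonZero p}} {n : ℕ} where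
  _+ᵥ_ : Vecₚ p n → Vecₚ p n → Vecₚ p n
  (x +ᵥ y) i = x i +ₚ y i

  _·_ : Vecₚ p n → Vecₚ p n → Fp p
  a · x = sumFin (λ i → toℕ (a i) * toℕ (x i)) mod p

  inSupp : Vecₚ p n → Fin n → Bool
  inSupp x i = not ⌊ x i ≟F zeroₚ ⌋

  inLv : Vecₚ p n → Vecₚ p n → Fin n → Bool
  inLv x y i = (inSupp x i ∨ inSupp y i) ∧ not (inSupp (x +ᵥ y) i)

  lvSize : Vecₚ p n → Vecₚ p n → ℕ
  lvSize x y = count (inLv x y)

  InP : Vecₚ p n → Fp p → Vecₚ p n → Set
  InP a b x = ¬ (a · x ≡ b) × (∀ i → T (inSupp x i) → T (inSupp a i))

data Lit (n p : ℕ) : Set where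
  pos : Fin n → Fin p → Lit n p
  neg : Fin n → Fin p → Lit n p

_==L_ : {n p : ℕ} → Lit n p → Lit n p → Bool
pos i k ==L pos j l = ⌊ i ≟F j ⌋ ∧ ⌊ k ≟F l ⌋
neg i k ==L neg j l = ⌊ i ≟F j ⌋ ∧ ⌊ k ≟F l ⌋
pos _ _ ==L neg _ _ = false
neg _ _ ==L pos _ _ = false

Clause : ℕ → ℕ → Set
Clause n p = Lit n p → Bool

_⊆C_ : {n p : ℕ} → Clause n p → Clause n p → Set
c ⊆C d = ∀ l → T (c l) → T (d l)

_≐_ : {n p : ℕ} → Clause n p → Clause n p → Set
c ≐ d = ∀ l → c l ≡ d l

-- A CNF formula: a set of clauses (closed under ≐ in all our uses).
Formula : ℕ → ℕ → Set₁
Formula n p = Clause n p → Set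

_∪F_ : {n p : ℕ} → Formula n p → Formula n p → Formula n p
(S ∪F T') c = S c ⊎ T' c

module _ {p : ℕ} .{{_ : NonZero p}} {n : ℕ} where
  Cₐ : Vecₚ p n → Vecₚ p n → Clause n p
  Cₐ a x (pos _ _) = false
  Cₐ a x (neg i k) = inSupp a i ∧ ⌊ k ≟F x i ⌋

  F : Vecₚ p n → Fp p → Formula n p
  F a b c = Σ (Vecₚ p n) λ x → InP a b x × (c ≐ Cₐ a x)

Vclause : {n p : ℕ} → Fin n → Clause n p
Vclause i (pos j _) = ⌊ j ≟F i ⌋
Vclause i (neg _ _) = false

V : {n p : ℕ} → Formula n p
V c = Σ _ λ i → c ≐ Vclause i

Resolvent : {n p : ℕ} → Clause n p → Clause n p → Clause n p → Set
Resolvent {n} {p} C D R =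
  Σ (Fin n) λ i → Σ (Fin p) λ k →
    T (C (pos i k)) × T (D (neg i k)) ×
    (∀ l → R l ≡ ((C l ∧ not (l ==L pos i k)) ∨ (D l ∧ not (l ==L neg i k))))

-- Deriv S cs m : cs (latest clause first) is a resolution derivation from S,
-- every entry being either a clause of S or a resolvent of two earlier
-- entries; m is the number of derived (resolvent) entries, i.e. its length.
data Deriv {n p : ℕ} (S : Formula n p) : List (Clause n p) → ℕ → Set where
  done : Deriv S [] 0
  axiom : ∀ {cs m c} → Deriv S cs m → S c → Deriv S (c ∷ cs) m
  resolve : ∀ {cs m C D c} → Deriv S cs m → C ∈ cs → D ∈ cs →
            Resolvent C D c → Deriv S (c ∷ cs) (suc m)

{-# OPTIONS --safe #-}
-- Fix x ∈ P(a₁ + a₂, b₁ + b₂), so the target clause is C_{a₁+a₂}(x). For any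
-- assignment g of the vanishing coordinates θ, the vector z that agrees with g on θ
-- and with x elsewhere has (a₁ + a₂)·z = (a₁ + a₂)·x ≠ b₁ + b₂, so a₁·z ≠ b₁ or
-- a₂·z ≠ b₂ and C_{a₁}(z) or C_{a₂}(z) is an axiom: it is the target clause
-- extended by the literals ¬ξ_{i,gᵢ}, i ∈ θ. These extra literals are removed one
-- coordinate j at a time by resolving the axiom ⋁ₖ ξ_{j,k} of V against the p
-- clauses obtained for the p values of gⱼ. This turns a bound L into p(L + 1), and
-- since p ≥ 2 it takes 2(p^t − 1) to at most 2(p^(t+1) − 1).
module Submission where

open import Defs
open import Data.Nat using (ℕ; zero; suc; _+_; _*_; _∸_; _^_; _≤_; _%_; NonZero; z≤n; s≤s)
open import Data.Nat.Properties
open import Data.Nat.DivMod using (_mod_; %-distribˡ-+; %-distribˡ-*; m%n%n≡m%n; m*n%n≡0)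
open import Data.Nat.Base using (nonTrivial⇒n>1)
open import Data.Nat.Primality using (Prime; prime⇒nonTrivial)
open import Data.Nat.Solver using (module +-*-Solver)
open import Data.Fin using (Fin; toℕ) renaming (zero to fzero; suc to fsuc)
open import Data.Fin.Properties using (toℕ-fromℕ<; toℕ-injective) renaming (_≟_ to _≟F_)
open import Data.Vec.Functional using (updateAt)
open import Data.Vec.Functional.Properties using (updateAt-updates; updateAt-minimal)
open import Data.Bool using (Bool; true; false; _∧_; _∨_; not; T; if_then_else_)
open import Data.Bool.Properties using (T-∧; T-∨; T-≡; T-not-≡)
open import Data.Product using (Σ; _×_; _,_; proj₁; proj₂)
open import Data.Sum using (_⊎_; inj₁; inj₂)
open import Data.Empty using (⊥; ⊥-elim)
open import Data.List using (List; []; _∷_; _++_; length; map; allFin)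
open import Data.List.Properties using (length-map; length-tabulate)
open import Data.List.Membership.Propositional using (_∈_; _∉_)
open import Data.List.Membership.Propositional.Properties using (∈-++⁺ˡ; ∈-++⁺ʳ; ∈-allFin; ∈-map⁺)
open import Data.List.Relation.Unary.Any as Any using (Any; here; there)
open import Function using (id; const)
open import Function.Bundles using (Equivalence)
open import Level using (0ℓ)
open import Relation.Nullary using (¬_; yes; no)
open import Relation.Nullary.Decidable using (⌊_⌋; toWitness; fromWitness)
open import Relation.Unary using (Pred; _∪_; _⊆_; ｛_｝)
open import Relation.Binary.PropositionalEquality

open Equivalence using (to; from)

≟-refl : ∀ {m} (i : Fin m) → T ⌊ i ≟F i ⌋
≟-refl i = fromWitness {a? = i ≟F i} refl

sumFin-cong : ∀ {n} {f g : Fin n → ℕ} → (∀ i → f i ≡ g i) → sumFin f ≡ sumFin g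
sumFin-cong {zero} e = refl
sumFin-cong {suc n} e = cong₂ _+_ (e fzero) (sumFin-cong (λ i → e (fsuc i)))

sumFin-+ : ∀ {n} (f g : Fin n → ℕ) → sumFin (λ i → f i + g i) ≡ sumFin f + sumFin g
sumFin-+ {zero} f g = refl
sumFin-+ {suc n} f g
  rewrite sumFin-+ (λ i → f (fsuc i)) (λ i → g (fsuc i)) =
  solve 4 (λ a b c d → (a :+ b) :+ (c :+ d) := (a :+ c) :+ (b :+ d)) refl
    (f fzero) (g fzero) (sumFin (λ i → f (fsuc i))) (sumFin (λ i → g (fsuc i)))
  where open +-*-Solver

enumeration : ∀ {n} (f : Fin n → Bool) →
              Σ (List (Fin n)) λ js → length js ≡ count f × (∀ i → T (f i) → i ∈ js)
enumeration {zero} f = [] , refl , λ ()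
enumeration {suc n} f with enumeration (λ i → f (fsuc i)) | f fzero in f₀
... | js , len , cover | true  = fzero ∷ map fsuc js , cong suc (trans (length-map fsuc js) len) , cover′
  where
  cover′ : ∀ i → T (f i) → i ∈ fzero ∷ map fsuc js
  cover′ fzero    _ = here refl
  cover′ (fsuc i) t = there (∈-map⁺ fsuc (cover i t))
... | js , len , cover | false = map fsuc js , trans (length-map fsuc js) len , cover′
  where
  cover′ : ∀ i → T (f i) → i ∈ map fsuc js
  cover′ fzero    t = ⊥-elim (subst T f₀ t)
  cover′ (fsuc i) t = ∈-map⁺ fsuc (cover i t)

m*[1+2[n∸1]]≤2[m*n∸1] : ∀ m n → 2 ≤ m → 1 ≤ n → m * suc (2 * (n ∸ 1)) ≤ 2 * (m * n ∸ 1)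
m*[1+2[n∸1]]≤2[m*n∸1] (suc (suc m)) (suc n) (s≤s (s≤s z≤n)) (s≤s z≤n) =
  ≤-trans (m≤m+n _ m) (≤-reflexive (solve 2 (λ m n →
    (con 2 :+ m) :* (con 1 :+ con 2 :* n) :+ m := con 2 :* (n :+ (con 1 :+ m) :* (con 1 :+ n))) refl m n))
  where open +-*-Solver

module _ {p : ℕ} .{{_ : NonZero p}} where

  sumFin-cong-% : ∀ {n} {f g : Fin n → ℕ} → (∀ i → f i % p ≡ g i % p) →
                  sumFin f % p ≡ sumFin g % p
  sumFin-cong-% {zero} e = refl
  sumFin-cong-% {suc n} {f} {g} e = begin
    (f fzero + sumFin (λ i → f (fsuc i))) % p
      ≡⟨ %-distribˡ-+ (f fzero) _ p ⟩
    (f fzero % p + sumFin (λ i → f (fsuc i)) % p) % p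
      ≡⟨ cong₂ (λ u v → (u + v) % p) (e fzero) (sumFin-cong-% (λ i → e (fsuc i))) ⟩
    (g fzero % p + sumFin (λ i → g (fsuc i)) % p) % p
      ≡⟨ %-distribˡ-+ (g fzero) _ p ⟨
    (g fzero + sumFin (λ i → g (fsuc i))) % p ∎
    where open ≡-Reasoning

  [m%p]*n%p≡m*n%p : ∀ m n → (m % p) * n % p ≡ m * n % p
  [m%p]*n%p≡m*n%p m n = begin
    (m % p) * n % p             ≡⟨ %-distribˡ-* (m % p) n p ⟩
    (m % p % p) * (n % p) % p   ≡⟨ cong (λ w → w * (n % p) % p) (m%n%n≡m%n m p) ⟩
    (m % p) * (n % p) % p       ≡⟨ %-distribˡ-* m n p ⟨
    m * n % p                   ∎
    where open ≡-Reasoning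

  toℕ-mod : ∀ m → toℕ (m mod p) ≡ m % p
  toℕ-mod m = toℕ-fromℕ< _

  toℕ-zeroₚ : toℕ (zeroₚ {p}) ≡ 0
  toℕ-zeroₚ = trans (toℕ-mod 0) (m*n%n≡0 0 p)

  module _ {n : ℕ} where

    ∉supp⇒toℕ≡0 : (v : Vecₚ p n) (i : Fin n) → T (not (inSupp v i)) → toℕ (v i) ≡ 0
    ∉supp⇒toℕ≡0 v i t with v i ≟F zeroₚ
    ... | yes vᵢ≡0 = trans (cong toℕ vᵢ≡0) toℕ-zeroₚ

    ·-distribʳ-+ᵥ : (a₁ a₂ z : Vecₚ p n) → (a₁ +ᵥ a₂) · z ≡ (a₁ · z) +ₚ (a₂ · z)
    ·-distribʳ-+ᵥ a₁ a₂ z = toℕ-injective (begin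
      toℕ ((a₁ +ᵥ a₂) · z)
        ≡⟨ toℕ-mod _ ⟩
      sumFin (λ i → toℕ (a₁ i +ₚ a₂ i) * toℕ (z i)) % p
        ≡⟨ cong (_% p) (sumFin-cong (λ i → cong (_* toℕ (z i)) (toℕ-mod (s i)))) ⟩
      sumFin (λ i → (s i % p) * toℕ (z i)) % p
        ≡⟨ sumFin-cong-% (λ i → [m%p]*n%p≡m*n%p (s i) (toℕ (z i))) ⟩
      sumFin (λ i → s i * toℕ (z i)) % p
        ≡⟨ cong (_% p) (sumFin-cong (λ i → *-distribʳ-+ (toℕ (z i)) (toℕ (a₁ i)) (toℕ (a₂ i)))) ⟩
      sumFin (λ i → t₁ i + t₂ i) % p
        ≡⟨ cong (_% p) (sumFin-+ t₁ t₂) ⟩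
      (sumFin t₁ + sumFin t₂) % p
        ≡⟨ %-distribˡ-+ (sumFin t₁) (sumFin t₂) p ⟩
      (sumFin t₁ % p + sumFin t₂ % p) % p
        ≡⟨ cong₂ (λ u v → (u + v) % p) (toℕ-mod (sumFin t₁)) (toℕ-mod (sumFin t₂)) ⟨
      (toℕ (a₁ · z) + toℕ (a₂ · z)) % p
        ≡⟨ toℕ-mod _ ⟨
      toℕ ((a₁ · z) +ₚ (a₂ · z)) ∎)
      where
      open ≡-Reasoning
      s t₁ t₂ : Fin n → ℕ
      s i = toℕ (a₁ i) + toℕ (a₂ i)
      t₁ i = toℕ (a₁ i) * toℕ (z i)
      t₂ i = toℕ (a₂ i) * toℕ (z i)

    ·-cong-supp : (a x y : Vecₚ p n) → (∀ i → T (inSupp a i) → x i ≡ y i) → a · x ≡ a · y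
    ·-cong-supp a x y e = cong (_mod p) (sumFin-cong termᵢ)
      where
      termᵢ : ∀ i → toℕ (a i) * toℕ (x i) ≡ toℕ (a i) * toℕ (y i)
      termᵢ i with inSupp a i in eq
      ... | true  = cong (λ v → toℕ (a i) * toℕ v) (e i (from T-≡ eq))
      ... | false rewrite ∉supp⇒toℕ≡0 a i (from T-not-≡ eq) = refl

module _ {p : ℕ} .{{_ : NonZero p}} {n : ℕ} where

  restrict : Vecₚ p n → Vecₚ p n → Vecₚ p n
  restrict a z i = if inSupp a i then z i else zeroₚ

  -- C_a(z) only reads z on supp(a), so restricting z to supp(a) exhibits it in F(a, b).
  Cₐ∈F : (a z : Vecₚ p n) (b : Fp p) → ¬ a · z ≡ b → F a b (Cₐ a z)
  Cₐ∈F a z b a·z≢b =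
    restrict a z , ((λ e → a·z≢b (trans (sym a·w≡a·z) e)) , supp-w⊆supp-a) , same-clause
    where
    a·w≡a·z : a · restrict a z ≡ a · z
    a·w≡a·z = ·-cong-supp a (restrict a z) z agree
      where
      agree : ∀ i → T (inSupp a i) → restrict a z i ≡ z i
      agree i t rewrite to T-≡ t = refl
    supp-w⊆supp-a : ∀ i → T (inSupp (restrict a z) i) → T (inSupp a i)
    supp-w⊆supp-a i t with inSupp a i
    ... | true  = _
    ... | false with zeroₚ {p} ≟F zeroₚ
    ...   | no z≢z = z≢z refl
    same-clause : Cₐ a z ≐ Cₐ a (restrict a z)
    same-clause (pos _ _) = refl
    same-clause (neg i k) with inSupp a i
    ... | true  = refl
    ... | false = refl

module _ {n p : ℕ} where

  ⟦_⟧ : Clause n p → Pred (Lit n p) 0ℓ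
  ⟦ c ⟧ l = T (c l)

  ==L-refl : (l : Lit n p) → T (l ==L l)
  ==L-refl (pos i k) = from T-∧ (≟-refl i , ≟-refl k)
  ==L-refl (neg i k) = from T-∧ (≟-refl i , ≟-refl k)

  literal-kept : ∀ {C : Clause n p} {x : Lit n p} {R : Pred (Lit n p) 0ℓ} → ⟦ C ⟧ ⊆ ｛ x ｝ ∪ R →
                 ∀ {l} → T (C l ∧ not (l ==L x)) → R l
  literal-kept {x = x} C⊆ t with to T-∧ t
  ... | Cl , l≠x with C⊆ Cl
  ...   | inj₁ refl = ⊥-elim (subst T (to T-not-≡ l≠x) (==L-refl x))
  ...   | inj₂ Rl = Rl

  record _⊢⟨_⟩_ (S : Formula n p) (B : ℕ) (P : Pred (Lit n p) 0ℓ) : Set where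
    constructor derivation
    field
      {clauses} : List (Clause n p)
      {steps}   : ℕ
      deriv     : Deriv S clauses steps
      steps≤    : steps ≤ B
      clause    : Clause n p
      clause∈   : clause ∈ clauses
      clause⊆   : ⟦ clause ⟧ ⊆ P

  infix 3 _⊢⟨_⟩_

  module _ {S : Formula n p} where

    Deriv-++ : ∀ {cs ds m m′} → Deriv S cs m → Deriv S ds m′ → Deriv S (ds ++ cs) (m′ + m)
    Deriv-++ d done                  = d
    Deriv-++ d (axiom e s)           = axiom (Deriv-++ d e) s
    Deriv-++ d (resolve e C∈ D∈ res) = resolve (Deriv-++ d e) (∈-++⁺ˡ C∈) (∈-++⁺ˡ D∈) res

    ⊢-weaken : ∀ {B B′ P Q} → B ≤ B′ → P ⊆ Q → S ⊢⟨ B ⟩ P → S ⊢⟨ B′ ⟩ Q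
    ⊢-weaken B≤B′ P⊆Q (derivation d m≤B c c∈ c⊆P) =
      derivation d (≤-trans m≤B B≤B′) c c∈ (λ t → P⊆Q (c⊆P t))

    ⊢-axiom : ∀ {c P} → S c → ⟦ c ⟧ ⊆ P → S ⊢⟨ 0 ⟩ P
    ⊢-axiom s c⊆P = derivation (axiom done s) z≤n _ (here refl) c⊆P

    ⊢-resolve : ∀ {m B P Q} j k →
                S ⊢⟨ m ⟩ ｛ pos j k ｝ ∪ P → S ⊢⟨ B ⟩ ｛ neg j k ｝ ∪ Q →
                S ⊢⟨ m + suc B ⟩ P ∪ Q
    ⊢-resolve {m} {B} {P} {Q} j k (derivation {steps = mE} dE mE≤m E E∈ E⊆)
                                  (derivation {ds} {mD} dD mD≤B D D∈ D⊆)
      with E (pos j k) in Eₚ | D (neg j k) in Dₙ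
    ... | false | _ = ⊢-weaken (m≤m+n m (suc B)) inj₁ (derivation dE mE≤m E E∈ E⊆P)
      where
      E⊆P : ⟦ E ⟧ ⊆ P
      E⊆P {l} t with E⊆ t
      ... | inj₁ refl = ⊥-elim (subst T Eₚ t)
      ... | inj₂ Pl = Pl
    ... | true | false = ⊢-weaken (≤-trans (n≤1+n B) (m≤n+m (suc B) m)) inj₂ (derivation dD mD≤B D D∈ D⊆Q)
      where
      D⊆Q : ⟦ D ⟧ ⊆ Q
      D⊆Q {l} t with D⊆ t
      ... | inj₁ refl = ⊥-elim (subst T Dₙ t)
      ... | inj₂ Ql = Ql
    ... | true | true =
      derivation (resolve (Deriv-++ dE dD) (∈-++⁺ʳ ds E∈) (∈-++⁺ˡ D∈) resolvent) bound
                 _ (here refl) R⊆P∪Q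
      where
      resolvent : Resolvent E D _
      resolvent = j , k , from T-≡ Eₚ , from T-≡ Dₙ , λ _ → refl
      bound : suc (mD + mE) ≤ m + suc B
      bound = begin
        suc (mD + mE) ≡⟨ cong suc (+-comm mD mE) ⟩
        suc (mE + mD) ≡⟨ +-suc mE mD ⟨
        mE + suc mD   ≤⟨ +-mono-≤ mE≤m (s≤s mD≤B) ⟩
        m + suc B     ∎
        where open ≤-Reasoning
      R⊆P∪Q : ⟦ (λ l → (E l ∧ not (l ==L pos j k)) ∨ (D l ∧ not (l ==L neg j k))) ⟧ ⊆ P ∪ Q
      R⊆P∪Q {l} t with to T-∨ t
      ... | inj₁ t₁ = inj₁ (literal-kept E⊆ t₁)
      ... | inj₂ t₂ = inj₂ (literal-kept D⊆ t₂)

    posLits : Fin n → List (Fin p) → Pred (Lit n p) 0ℓ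
    posLits j ks l = Any (λ k → pos j k ≡ l) ks

    ⊢-resolve-all : ∀ {m B P} j ks →
                    S ⊢⟨ m ⟩ posLits j ks ∪ P → (∀ k → S ⊢⟨ B ⟩ ｛ neg j k ｝ ∪ P) →
                    S ⊢⟨ m + length ks * suc B ⟩ P
    ⊢-resolve-all {m} {P = P} j [] d _ = ⊢-weaken (m≤m+n m 0) P-only d
      where
      P-only : posLits j [] ∪ P ⊆ P
      P-only (inj₂ Pl) = Pl
    ⊢-resolve-all {m} {B} {P} j (k ∷ ks) d dₖ =
      ⊢-weaken (≤-reflexive (+-assoc m (suc B) _)) id
        (⊢-resolve-all j ks (⊢-weaken ≤-refl merge (⊢-resolve j k (⊢-weaken ≤-refl split d) (dₖ k))) dₖ)
      where
      split : posLits j (k ∷ ks) ∪ P ⊆ ｛ pos j k ｝ ∪ posLits j ks ∪ P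
      split (inj₁ (here e))  = inj₁ e
      split (inj₁ (there q)) = inj₂ (inj₁ q)
      split (inj₂ Pl)        = inj₂ (inj₂ Pl)
      merge : (posLits j ks ∪ P) ∪ P ⊆ posLits j ks ∪ P
      merge (inj₁ q)  = q
      merge (inj₂ Pl) = inj₂ Pl

    ⊢-eliminate : ∀ {B P} j → S (Vclause j) → (∀ k → S ⊢⟨ B ⟩ ｛ neg j k ｝ ∪ P) →
                  S ⊢⟨ p * suc B ⟩ P
    ⊢-eliminate {B} {P} j V∈S dₖ =
      ⊢-weaken (≤-reflexive (cong (_* suc B) (length-tabulate {n = p} id))) id
        (⊢-resolve-all j (allFin p) (⊢-axiom V∈S V⊆) dₖ)
      where
      V⊆ : ⟦ Vclause j ⟧ ⊆ posLits j (allFin p) ∪ P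
      V⊆ {pos i k} t with toWitness {a? = i ≟F j} t
      ... | refl = inj₁ (Any.map (λ k≡x → cong (pos i) (sym k≡x)) (∈-allFin k))

module Elimination {p : ℕ} .{{_ : NonZero p}} (2≤p : 2 ≤ p) {n : ℕ} (a₁ a₂ : Vecₚ p n)
                   (b₁ b₂ : Fp p) (x : Vecₚ p n) (x∈P : InP (a₁ +ᵥ a₂) (b₁ +ₚ b₂) x) where

  a : Vecₚ p n
  a = a₁ +ᵥ a₂

  S : Formula n p
  S = (F a₁ b₁ ∪F F a₂ b₂) ∪F V

  θ : Fin n → Bool
  θ = inLv a₁ a₂

  θ⇒∉supp : ∀ {i} → T (θ i) → T (not (inSupp a i))
  θ⇒∉supp t = proj₂ (to T-∧ t)

  ∉θ⇒∈supp : ∀ {i} → T (inSupp a₁ i ∨ inSupp a₂ i) → θ i ≡ false → T (inSupp a i)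
  ∉θ⇒∈supp {i} t θᵢ with inSupp a₁ i ∨ inSupp a₂ i | inSupp a i
  ... | true | true = _

  Target : List (Fin n) → Vecₚ p n → Pred (Lit n p) 0ℓ
  Target js g (pos _ _) = ⊥
  Target js g (neg i k) = (T (inSupp a i) × k ≡ x i) ⊎ (T (θ i) × i ∉ js × k ≡ g i)

  module _ (g : Vecₚ p n) where

    z : Vecₚ p n
    z i = if θ i then g i else x i

    z-by-θ : ∀ {i b} → θ i ≡ b → z i ≡ (if b then g i else x i)
    z-by-θ {i} = cong (λ b → if b then g i else x i)

    a·z≡a·x : a · z ≡ a · x
    a·z≡a·x = ·-cong-supp a z x agree
      where
      agree : ∀ i → T (inSupp a i) → z i ≡ x i
      agree i t with θ i in θᵢ
      ... | true  = ⊥-elim (subst T (to T-not-≡ (θ⇒∉supp (from T-≡ θᵢ))) t)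
      ... | false = refl

    Cₐz⊆Target : ∀ a′ → (∀ {i} → T (inSupp a′ i) → T (inSupp a₁ i ∨ inSupp a₂ i)) →
                 ⟦ Cₐ a′ z ⟧ ⊆ Target [] g
    Cₐz⊆Target a′ supp⊆ {neg i k} t = classify (θ i) refl
      where
      i∈supp,k≟zᵢ : T (inSupp a′ i) × T ⌊ k ≟F z i ⌋
      i∈supp,k≟zᵢ = to T-∧ t
      k≡zᵢ : k ≡ z i
      k≡zᵢ = toWitness (proj₂ i∈supp,k≟zᵢ)
      classify : ∀ b → θ i ≡ b → Target [] g (neg i k)
      classify true  θᵢ = inj₂ (from T-≡ θᵢ , (λ ()) , trans k≡zᵢ (z-by-θ θᵢ))
      classify false θᵢ = inj₁ (∉θ⇒∈supp (supp⊆ (proj₁ i∈supp,k≟zᵢ)) θᵢ , trans k≡zᵢ (z-by-θ θᵢ))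

    base : S ⊢⟨ 0 ⟩ Target [] g
    base with a₁ · z ≟F b₁ | a₂ · z ≟F b₂
    ... | no a₁·z≢b₁ | _ =
      ⊢-axiom (inj₁ (inj₁ (Cₐ∈F a₁ z b₁ a₁·z≢b₁))) (Cₐz⊆Target a₁ (λ t → from T-∨ (inj₁ t)))
    ... | yes _ | no a₂·z≢b₂ =
      ⊢-axiom (inj₁ (inj₂ (Cₐ∈F a₂ z b₂ a₂·z≢b₂))) (Cₐz⊆Target a₂ (λ t → from T-∨ (inj₂ t)))
    ... | yes a₁·z≡b₁ | yes a₂·z≡b₂ = ⊥-elim (proj₁ x∈P (begin
      a · x                  ≡⟨ a·z≡a·x ⟨
      a · z                  ≡⟨ ·-distribʳ-+ᵥ a₁ a₂ z ⟩
      (a₁ · z) +ₚ (a₂ · z)   ≡⟨ cong₂ _+ₚ_ a₁·z≡b₁ a₂·z≡b₂ ⟩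
      b₁ +ₚ b₂               ∎))
      where open ≡-Reasoning

  unpin : ∀ j js g k → Target js (updateAt g j (const k)) ⊆ ｛ neg j k ｝ ∪ Target (j ∷ js) g
  unpin j js g k {neg i k′} (inj₁ q) = inj₂ (inj₁ q)
  unpin j js g k {neg i k′} (inj₂ (θᵢ , i∉js , k′≡)) with i ≟F j
  ... | yes refl = inj₁ (cong (neg i) (sym (trans k′≡ (updateAt-updates i g))))
  ... | no i≢j   = inj₂ (inj₂ (θᵢ , i∉j∷js , trans k′≡ (updateAt-minimal i j g i≢j)))
    where
    i∉j∷js : i ∉ j ∷ js
    i∉j∷js (here i≡j) = i≢j i≡j
    i∉j∷js (there i∈js) = i∉js i∈js

  target-derivable : ∀ js g → S ⊢⟨ 2 * (p ^ length js ∸ 1) ⟩ Target js g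
  target-derivable []       g = base g
  target-derivable (j ∷ js) g =
    ⊢-weaken (m*[1+2[n∸1]]≤2[m*n∸1] p (p ^ length js) 2≤p (m^n>0 p (length js))) id
      (⊢-eliminate j (inj₂ (j , λ _ → refl)) λ k →
        ⊢-weaken ≤-refl (unpin j js g k) (target-derivable js (updateAt g j (const k))))

  Cₐx-derivable : S ⊢⟨ 2 * (p ^ lvSize a₁ a₂ ∸ 1) ⟩ ⟦ Cₐ a x ⟧
  Cₐx-derivable with enumeration θ
  ... | js , |js|≡|θ| , θ⊆js =
    ⊢-weaken (≤-reflexive (cong (λ L → 2 * (p ^ L ∸ 1)) |js|≡|θ|)) Target⊆Cₐx (target-derivable js x)
    where
    Target⊆Cₐx : Target js x ⊆ ⟦ Cₐ a x ⟧
    Target⊆Cₐx {neg i k} (inj₁ (i∈supp , refl)) = from T-∧ (i∈supp , ≟-refl k)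
    Target⊆Cₐx {neg i k} (inj₂ (θᵢ , i∉js , _)) = ⊥-elim (i∉js (θ⊆js i θᵢ))

theorem4p2 : (p : ℕ) .{{_ : NonZero p}} → Prime p → (n : ℕ) →
    (a₁ a₂ : Vecₚ p n) (b₁ b₂ : Fp p) (c : Clause n p) →
    F (a₁ +ᵥ a₂) (b₁ +ₚ b₂) c →
    Σ (List (Clause n p)) λ cs → Σ ℕ λ m →
      Deriv ((F a₁ b₁ ∪F F a₂ b₂) ∪F V) cs m ×
      m ≤ 2 * (p ^ lvSize a₁ a₂ ∸ 1) ×
      Σ (Clause n p) λ c′ → (c′ ∈ cs) × (c′ ⊆C c)
theorem4p2 p pr _ a₁ a₂ b₁ b₂ _ (x , x∈P , c≐Cₐx)
  with Elimination.Cₐx-derivable (nonTrivial⇒n>1 p {{prime⇒nonTrivial pr}}) a₁ a₂ b₁ b₂ x x∈P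
... | derivation d m≤ c′ c′∈ c′⊆Cₐx =
  _ , _ , d , m≤ , c′ , c′∈ , λ l t → subst T (sym (c≐Cₐx l)) (c′⊆Cₐx t)
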